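{- Let $G$ be a connected $4$-regular bipartite graph with partite sets $B_1,B_2$ satisfying $|B_1|\geq 2$ and $|B_2|\geq 2$, and let $\hat{G}$ be its bipartite extension. Then $\alpha_2(\hat{G})=\alpha_2(G)$.
   Context: Graphs are finite, undirected, possibly with parallel edges, without loops. $\alpha_2(H)$ is the maximum size of a set of vertices of $H$ with pairwise graph distance greater than $2$. Bipartite extension: given a bipartite graph $G$ with partite sets $B_1,B_2$, form $\hat G$ from $G$ by adding a set $A_1=\{a_w: w\in B_2\}$ (a copy of $B_2$) where $a_w$ is joined to each $b\in B_1$ by as many edges as join $w$ and $b$ in $G$; adding a set $A_2=\{a'_u: u\in B_1\}$ (a copy of $B_1$) where $a'_u$ is joined to each $w\in B_2$ by as many edges as join $u$ and $w$ in $G$; and adding one edge between every $a\in A_1$ and every $a'\in A_2$. -}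

module Defs where

open import Data.Nat using (ℕ; _<_; _≤_)
open import Data.Fin using (Fin)
open import Data.Sum using (_⊎_; inj₁; inj₂)
open import Data.Product using (Σ; _×_; ∃-syntax)
open import Data.List using (List; length; map; allFin)
open import Data.Nat.ListAction using (sum)
open import Data.List.Relation.Unary.AllPairs using (AllPairs)
open import Relation.Binary.PropositionalEquality using (_≡_; refl)
open import Relation.Nullary using (¬_)

record Multigraph : Set₁ where
  field
    V        : Set
    mult     : V → V → ℕ
    mult-sym : ∀ u v → mult u v ≡ mult v u
    loopless : ∀ v → mult v v ≡ 0

module _ (H : Multigraph) where
  open Multigraph H

  Adj : V → V → Set
  Adj u v = 0 < mult u v

  DistLe2 : V → V → Set
  DistLe2 u v = u ≡ v ⊎ (Adj u v ⊎ ∃[ w ] (Adj u w × Adj w v))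

  Is2Packing : List V → Set
  Is2Packing xs = AllPairs (λ u v → ¬ DistLe2 u v) xs

  IsAlpha2 : ℕ → Set
  IsAlpha2 k = (Σ (List V) λ xs → Is2Packing xs × length xs ≡ k)
             × (∀ xs → Is2Packing xs → length xs ≤ k)

  data Reachable : V → V → Set where
    here : ∀ {v} → Reachable v v
    step : ∀ {u w v} → Adj u w → Reachable w v → Reachable u v

  Connected : Set
  Connected = ∀ u v → Reachable u v

-- A bipartite multigraph with partite sets B₁ = Fin p, B₂ = Fin q,
-- given by m u w = number of edges joining u ∈ B₁ and w ∈ B₂.
BipMult : ℕ → ℕ → Set
BipMult p q = Fin p → Fin q → ℕ

module _ {p q : ℕ} (m : BipMult p q) where

  bipMult : Fin p ⊎ Fin q → Fin p ⊎ Fin q → ℕ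
  bipMult (inj₁ u) (inj₂ w) = m u w
  bipMult (inj₂ w) (inj₁ u) = m u w
  bipMult (inj₁ _) (inj₁ _) = 0
  bipMult (inj₂ _) (inj₂ _) = 0

  bipGraph : Multigraph
  bipGraph = record
    { V = Fin p ⊎ Fin q
    ; mult = bipMult
    ; mult-sym = λ { (inj₁ _) (inj₁ _) → refl ; (inj₁ _) (inj₂ _) → refl
                   ; (inj₂ _) (inj₁ _) → refl ; (inj₂ _) (inj₂ _) → refl }
    ; loopless = λ { (inj₁ _) → refl ; (inj₂ _) → refl }
    }

  FourRegular : Set
  FourRegular = (∀ u → sum (map (m u) (allFin q)) ≡ 4)
              × (∀ w → sum (map (λ u → m u w) (allFin p)) ≡ 4)

data ExtV (p q : ℕ) : Set where
  b₁ : Fin p → ExtV p q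
  b₂ : Fin q → ExtV p q
  a₁ : Fin q → ExtV p q     -- A₁ : a_w for w ∈ B₂
  a₂ : Fin p → ExtV p q     -- A₂ : a'_u for u ∈ B₁

module _ {p q : ℕ} (m : BipMult p q) where

  extMult : ExtV p q → ExtV p q → ℕ
  extMult (b₁ u) (b₂ w) = m u w
  extMult (b₂ w) (b₁ u) = m u w
  extMult (a₁ w) (b₁ u) = m u w
  extMult (b₁ u) (a₁ w) = m u w
  extMult (a₂ u) (b₂ w) = m u w
  extMult (b₂ w) (a₂ u) = m u w
  extMult (a₁ _) (a₂ _) = 1
  extMult (a₂ _) (a₁ _) = 1
  extMult (b₁ _) (b₁ _) = 0
  extMult (b₁ _) (a₂ _) = 0
  extMult (b₂ _) (b₂ _) = 0
  extMult (b₂ _) (a₁ _) = 0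
  extMult (a₁ _) (b₂ _) = 0
  extMult (a₁ _) (a₁ _) = 0
  extMult (a₂ _) (b₁ _) = 0
  extMult (a₂ _) (a₂ _) = 0

  extMult-sym : ∀ x y → extMult x y ≡ extMult y x
  extMult-sym (b₁ _) (b₁ _) = refl
  extMult-sym (b₁ _) (b₂ _) = refl
  extMult-sym (b₁ _) (a₁ _) = refl
  extMult-sym (b₁ _) (a₂ _) = refl
  extMult-sym (b₂ _) (b₁ _) = refl
  extMult-sym (b₂ _) (b₂ _) = refl
  extMult-sym (b₂ _) (a₁ _) = refl
  extMult-sym (b₂ _) (a₂ _) = refl
  extMult-sym (a₁ _) (b₁ _) = refl
  extMult-sym (a₁ _) (b₂ _) = refl
  extMult-sym (a₁ _) (a₁ _) = refl
  extMult-sym (a₁ _) (a₂ _) = refl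
  extMult-sym (a₂ _) (b₁ _) = refl
  extMult-sym (a₂ _) (b₂ _) = refl
  extMult-sym (a₂ _) (a₁ _) = refl
  extMult-sym (a₂ _) (a₂ _) = refl

  extLoopless : ∀ x → extMult x x ≡ 0
  extLoopless (b₁ _) = refl
  extLoopless (b₂ _) = refl
  extLoopless (a₁ _) = refl
  extLoopless (a₂ _) = refl

  bipExt : Multigraph
  bipExt = record { V = ExtV p q ; mult = extMult ; mult-sym = extMult-sym ; loopless = extLoopless }

{-# OPTIONS --safe #-}
module Submission where

-- Identifying each new vertex a_w with w and a'_u with u collapses Ĝ onto G.
-- The collapse and the inclusion G ⊆ Ĝ both reflect "distance ≤ 2", so each
-- maps 2-packings to 2-packings of the same size, and α₂ agrees.  The only
-- delicate pairs are distinct vertices with the same image, such as w and a_w: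
-- they have the same neighbours in B₁, hence are at distance 2 as soon as w has
-- a neighbour, which 4-regularity provides.

open import Defs
open import Data.Nat using (ℕ; _≤_; _<_; zero; suc; z≤n; s≤s)
open import Data.Nat.ListAction using (sum)
open import Data.Fin using (Fin)
open import Data.Sum using (_⊎_; inj₁; inj₂)
open import Data.Product using (_,_; ∃-syntax)
open import Data.List using (List; []; _∷_; map; allFin)
open import Data.List.Properties using (length-map)
import Data.List.Relation.Unary.AllPairs as AllPairs
open import Data.List.Relation.Unary.AllPairs.Properties using (map⁺)
open import Function.Bundles using (_⇔_; mk⇔)
open import Relation.Binary.PropositionalEquality using (_≡_; refl; sym; trans; cong; subst)

sum-map-pos⇒∃-pos : {A : Set} (g : A → ℕ) (xs : List A) → 0 < sum (map g xs) → ∃[ x ] 0 < g x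
sum-map-pos⇒∃-pos g []       ()
sum-map-pos⇒∃-pos g (x ∷ xs) pos with g x in gx≡
... | zero  = sum-map-pos⇒∃-pos g xs pos
... | suc _ = x , subst (0 <_) (sym gx≡) (s≤s z≤n)

Adj-sym : (G : Multigraph) (u v : Multigraph.V G) → Adj G u v → Adj G v u
Adj-sym G u v = subst (0 <_) (Multigraph.mult-sym G u v)

ReflectsDistLe2 : (G H : Multigraph) → (Multigraph.V G → Multigraph.V H) → Set
ReflectsDistLe2 G H f = ∀ x y → DistLe2 H (f x) (f y) → DistLe2 G x y

Is2Packing-map : (G H : Multigraph) (f : Multigraph.V G → Multigraph.V H) → ReflectsDistLe2 G H f
               → ∀ xs → Is2Packing G xs → Is2Packing H (map f xs)
Is2Packing-map G H f reflects xs packing =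
  map⁺ (AllPairs.map (λ {x} {y} far near → far (reflects x y near)) packing)

IsAlpha2-transfer : (G H : Multigraph) (f : Multigraph.V G → Multigraph.V H) (g : Multigraph.V H → Multigraph.V G)
                  → ReflectsDistLe2 G H f → ReflectsDistLe2 H G g
                  → ∀ k → IsAlpha2 G k → IsAlpha2 H k
IsAlpha2-transfer G H f g f-reflects g-reflects k ((xs , packing , length≡k) , maximal) =
    (map f xs , Is2Packing-map G H f f-reflects xs packing , trans (length-map f xs) length≡k)
  , λ ys packing′ → subst (_≤ k) (length-map g ys) (maximal (map g ys) (Is2Packing-map H G g g-reflects ys packing′))

IsAlpha2-⇔ : (G H : Multigraph) (f : Multigraph.V G → Multigraph.V H) (g : Multigraph.V H → Multigraph.V G)
           → ReflectsDistLe2 G H f → ReflectsDistLe2 H G g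
           → ∀ k → IsAlpha2 G k ⇔ IsAlpha2 H k
IsAlpha2-⇔ G H f g f-reflects g-reflects k =
  mk⇔ (IsAlpha2-transfer G H f g f-reflects g-reflects k) (IsAlpha2-transfer H G g f g-reflects f-reflects k)

module _ {p q : ℕ} (m : BipMult p q) where

  private
    G = bipGraph m
    Ĝ = bipExt m

  collapse : ExtV p q → Fin p ⊎ Fin q
  collapse (b₁ u) = inj₁ u
  collapse (a₂ u) = inj₁ u
  collapse (b₂ w) = inj₂ w
  collapse (a₁ w) = inj₂ w

  embed : Fin p ⊎ Fin q → ExtV p q
  embed (inj₁ u) = b₁ u
  embed (inj₂ w) = b₂ w

  collapse-embed : ∀ x → collapse (embed x) ≡ x
  collapse-embed (inj₁ _) = refl
  collapse-embed (inj₂ _) = refl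

  embed-injective : ∀ x y → embed x ≡ embed y → x ≡ y
  embed-injective x y e = trans (sym (collapse-embed x)) (trans (cong collapse e) (collapse-embed y))

  collapse-reflects-Adj : ∀ x y → Adj G (collapse x) (collapse y) → Adj Ĝ x y
  collapse-reflects-Adj (b₁ _) (b₂ _) adj = adj
  collapse-reflects-Adj (b₁ _) (a₁ _) adj = adj
  collapse-reflects-Adj (a₂ _) (b₂ _) adj = adj
  collapse-reflects-Adj (a₂ _) (a₁ _) _   = s≤s z≤n
  collapse-reflects-Adj (b₂ _) (b₁ _) adj = adj
  collapse-reflects-Adj (b₂ _) (a₂ _) adj = adj
  collapse-reflects-Adj (a₁ _) (b₁ _) adj = adj
  collapse-reflects-Adj (a₁ _) (a₂ _) _   = s≤s z≤n
  collapse-reflects-Adj (b₁ _) (b₁ _) ()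
  collapse-reflects-Adj (b₁ _) (a₂ _) ()
  collapse-reflects-Adj (a₂ _) (b₁ _) ()
  collapse-reflects-Adj (a₂ _) (a₂ _) ()
  collapse-reflects-Adj (b₂ _) (b₂ _) ()
  collapse-reflects-Adj (b₂ _) (a₁ _) ()
  collapse-reflects-Adj (a₁ _) (b₂ _) ()
  collapse-reflects-Adj (a₁ _) (a₁ _) ()

  embed-Adj : ∀ x z → Adj Ĝ (embed x) z → Adj G x (collapse z)
  embed-Adj (inj₁ _) (b₂ _) adj = adj
  embed-Adj (inj₁ _) (a₁ _) adj = adj
  embed-Adj (inj₂ _) (b₁ _) adj = adj
  embed-Adj (inj₂ _) (a₂ _) adj = adj
  embed-Adj (inj₁ _) (b₁ _) ()
  embed-Adj (inj₁ _) (a₂ _) ()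
  embed-Adj (inj₂ _) (b₂ _) ()
  embed-Adj (inj₂ _) (a₁ _) ()

  embed-reflects-DistLe2 : ReflectsDistLe2 G Ĝ embed
  embed-reflects-DistLe2 x y (inj₁ e) = inj₁ (embed-injective x y e)
  embed-reflects-DistLe2 x y (inj₂ (inj₁ adj)) =
    inj₂ (inj₁ (subst (Adj G x) (collapse-embed y) (embed-Adj x (embed y) adj)))
  embed-reflects-DistLe2 x y (inj₂ (inj₂ (z , adj₁ , adj₂))) =
    inj₂ (inj₂ (collapse z , embed-Adj x z adj₁ , Adj-sym G y (collapse z) (embed-Adj y z (Adj-sym Ĝ z (embed y) adj₂))))

  module _ (neighbour₁ : ∀ u → ∃[ w ] 0 < m u w) (neighbour₂ : ∀ w → ∃[ u ] 0 < m u w) where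

    collapse-fibre-DistLe2 : ∀ x y → collapse x ≡ collapse y → DistLe2 Ĝ x y
    collapse-fibre-DistLe2 (b₁ _) (b₁ _) refl = inj₁ refl
    collapse-fibre-DistLe2 (a₂ _) (a₂ _) refl = inj₁ refl
    collapse-fibre-DistLe2 (b₂ _) (b₂ _) refl = inj₁ refl
    collapse-fibre-DistLe2 (a₁ _) (a₁ _) refl = inj₁ refl
    collapse-fibre-DistLe2 (b₁ u) (a₂ _) refl = let (w , adj) = neighbour₁ u in inj₂ (inj₂ (b₂ w , adj , adj))
    collapse-fibre-DistLe2 (a₂ u) (b₁ _) refl = let (w , adj) = neighbour₁ u in inj₂ (inj₂ (b₂ w , adj , adj))
    collapse-fibre-DistLe2 (b₂ w) (a₁ _) refl = let (u , adj) = neighbour₂ w in inj₂ (inj₂ (b₁ u , adj , adj))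
    collapse-fibre-DistLe2 (a₁ w) (b₂ _) refl = let (u , adj) = neighbour₂ w in inj₂ (inj₂ (b₁ u , adj , adj))

    collapse-reflects-DistLe2 : ReflectsDistLe2 Ĝ G collapse
    collapse-reflects-DistLe2 x y (inj₁ e) = collapse-fibre-DistLe2 x y e
    collapse-reflects-DistLe2 x y (inj₂ (inj₁ adj)) = inj₂ (inj₁ (collapse-reflects-Adj x y adj))
    collapse-reflects-DistLe2 x y (inj₂ (inj₂ (z , adj₁ , adj₂))) =
      inj₂ (inj₂ (embed z , collapse-reflects-Adj x (embed z) (subst (Adj G (collapse x)) (sym (collapse-embed z)) adj₁)
                          , collapse-reflects-Adj (embed z) y (subst (λ t → Adj G t (collapse y)) (sym (collapse-embed z)) adj₂)))

  FourRegular⇒neighbour₁ : FourRegular m → ∀ u → ∃[ w ] 0 < m u w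
  FourRegular⇒neighbour₁ (deg₁ , _) u = sum-map-pos⇒∃-pos (m u) (allFin q) (subst (0 <_) (sym (deg₁ u)) (s≤s z≤n))

  FourRegular⇒neighbour₂ : FourRegular m → ∀ w → ∃[ u ] 0 < m u w
  FourRegular⇒neighbour₂ (_ , deg₂) w = sum-map-pos⇒∃-pos (λ u → m u w) (allFin p) (subst (0 <_) (sym (deg₂ w)) (s≤s z≤n))

lemma4p3 : (p q : ℕ) (m : BipMult p q) → 2 ≤ p → 2 ≤ q
         → FourRegular m → Connected (bipGraph m)
         → ∀ k → IsAlpha2 (bipGraph m) k ⇔ IsAlpha2 (bipExt m) k
lemma4p3 p q m _ _ regular _ =
  IsAlpha2-⇔ (bipGraph m) (bipExt m) (embed m) (collapse m)
    (embed-reflects-DistLe2 m)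
    (collapse-reflects-DistLe2 m (FourRegular⇒neighbour₁ m regular) (FourRegular⇒neighbour₂ m regular))
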